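{- (i) $\mathrm{ex}_<(n,P_5^{1423})=\binom n2$, and (ii) $\mathrm{ex}_<(n,P_5^{2413})=\binom n2$.
   Context: Edge-ordered graph: finite simple graph with a linear order on its edges; isomorphisms preserve order; subgraphs carry induced order; $\mathrm{ex}_<(n,H)$ is the maximum number of edges of an edge-ordered graph on $n$ vertices with no subgraph isomorphic to $H$. Notation: $P_k^{a_1\dots a_{k-1}}$ is the path $v_1\dots v_k$ where edge $v_iv_{i+1}$ has label $a_i$ and edges are ordered by label. -}

module Defs where

open import Data.Nat using (ℕ; _<_; _≤_; _<?_)
open import Data.Fin using (Fin; toℕ; inject₁; suc)
open import Data.Maybe using (Maybe; just; nothing; is-just)
open import Data.Bool using (Bool; true; false; T)
open import Data.List using (List; length; filter; allFin; cartesianProduct)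
open import Data.Product using (Σ; _×_; _,_; proj₁; proj₂)
open import Data.Sum using (_⊎_)
open import Data.Nat.Combinatorics using (_C_)
open import Function.Definitions using (Injective)
open import Relation.Binary.PropositionalEquality using (_≡_)
open import Relation.Nullary using (¬_; Dec)
open import Relation.Nullary.Decidable using (_×-dec_)
open import Data.Bool.Properties using (T?)

-- An edge-ordered (finite simple) graph on vertex set Fin n.
-- lab u v = nothing  : u,v not adjacent
-- lab u v = just k   : uv is an edge with label k.
-- The linear order on edges is given by comparing (pairwise distinct) labels.
-- Every linear order on a finite edge set arises this way.
record EOGraph (n : ℕ) : Set where
  field
    lab    : Fin n → Fin n → Maybe ℕ
    lab-sym    : ∀ u v → lab u v ≡ lab v u
    lab-irrefl : ∀ u → lab u u ≡ nothing
    lab-inj    : ∀ u v x y k → lab u v ≡ just k → lab x y ≡ just k →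
                 (u ≡ x × v ≡ y) ⊎ (u ≡ y × v ≡ x)
open EOGraph public

numEdges : ∀ {n} → EOGraph n → ℕ
numEdges {n} G = length (filter isEdge? (cartesianProduct (allFin n) (allFin n)))
  where
  isEdge? : (p : Fin n × Fin n) → Dec (toℕ (proj₁ p) < toℕ (proj₂ p) × T (is-just (lab G (proj₁ p) (proj₂ p))))
  isEdge? (u , v) = (toℕ u <? toℕ v) ×-dec T? (is-just (lab G u v))

-- G contains a subgraph isomorphic to the edge-ordered path P_5^{a}, where
-- a : Fin 4 → ℕ gives the (distinct) labels a_1..a_4 of the edges v_i v_{i+1}.
ContainsP5 : ∀ {n} → EOGraph n → (Fin 4 → ℕ) → Set
ContainsP5 {n} G a =
  Σ (Fin 5 → Fin n) λ w → Injective _≡_ _≡_ w ×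
  Σ (Fin 4 → ℕ) λ ℓ →
    (∀ i → lab G (w (inject₁ i)) (w (suc i)) ≡ just (ℓ i)) ×
    (∀ i j → a i < a j → ℓ i < ℓ j)

ExP5≡ : ℕ → (Fin 4 → ℕ) → ℕ → Set
ExP5≡ n a m =
  (Σ (EOGraph n) λ G → ¬ ContainsP5 G a × numEdges G ≡ m) ×
  (∀ (G : EOGraph n) → ¬ ContainsP5 G a → numEdges G ≤ m)

p1423 : Fin 4 → ℕ
p1423 Fin.zero = 1
p1423 (suc Fin.zero) = 4
p1423 (suc (suc Fin.zero)) = 2
p1423 (suc (suc (suc Fin.zero))) = 3

p2413 : Fin 4 → ℕ
p2413 Fin.zero = 2
p2413 (suc Fin.zero) = 4
p2413 (suc (suc Fin.zero)) = 1
p2413 (suc (suc (suc Fin.zero))) = 3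

-- Any edge-ordered graph on n vertices has at most n C 2 edges, so it suffices to order the
-- edges of Kₙ so that neither path occurs. Order them colexicographically (larger endpoint
-- first, then smaller). In both P₅^{1423} and P₅^{2413} the last edge v₄v₅ comes after v₁v₂
-- and v₃v₄ but before v₂v₃. In colex order, v₁v₂ < v₄v₅ and v₃v₄ < v₄v₅ put the vertices v₂
-- and v₃, which differ from v₄ and v₅, strictly below max(v₄, v₅); hence v₂v₃ < v₄v₅.
module Submission where

open import Defs
open import Data.Nat using (ℕ; zero; suc; _+_; _*_; _∸_; _<_; _≤_; _<?_; _⊔_; _⊓_; s≤s; z<s; s<s)
open import Data.Nat.Properties
open import Data.Nat.ListAction using (sum)
open import Data.Nat.Combinatorics using (_C_; nC1≡n; nCk+nC[k+1]≡[n+1]C[k+1])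
open import Data.Fin using (Fin; toℕ; inject₁; #_) renaming (zero to fz; suc to fs)
open import Data.Fin.Properties using (toℕ-injective; toℕ<n) renaming (_≟_ to _≟ᶠ_)
open import Data.Maybe using (Maybe; just; nothing; is-just)
open import Data.Maybe.Properties using (just-injective)
open import Data.List using (List; []; _∷_; _++_; map; length; filter; allFin; tabulate; cartesianProduct)
open import Data.List.Properties using (length-++; filter-++; filter-all; filter-accept; filter-reject; filter-≐; length-tabulate; map-tabulate; map-cong)
open import Data.List.Relation.Unary.All using (universal)
open import Data.List.Relation.Binary.Sublist.Propositional using (⊆-refl)
open import Data.List.Relation.Binary.Sublist.Propositional.Properties using (filter⁺; length-mono-≤)
open import Data.Product using (_×_; _,_; proj₁; proj₂)
open import Data.Sum using (_⊎_; inj₁; inj₂; [_,_]′)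
open import Data.Unit using (tt)
open import Data.Bool using (T)
open import Function using (id; _∘_)
open import Relation.Binary.PropositionalEquality
open import Relation.Nullary using (¬_; Dec; yes; no; contradiction)
open import Relation.Unary using (Pred; Decidable)
open import Level using (0ℓ)

length-filter-map : ∀ {A B : Set} {P : Pred B 0ℓ} (P? : Decidable P) (f : A → B) xs →
                    length (filter P? (map f xs)) ≡ length (filter (P? ∘ f) xs)
length-filter-map P? f [] = refl
length-filter-map {P = P} P? f (x ∷ xs) = by-cases (P? (f x))
  where
  open ≡-Reasoning
  by-cases : Dec (P (f x)) → length (filter P? (map f (x ∷ xs))) ≡ length (filter (P? ∘ f) (x ∷ xs))
  by-cases (yes Pfx) = begin
    length (filter P? (f x ∷ map f xs)) ≡⟨ cong length (filter-accept P? Pfx) ⟩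
    suc (length (filter P? (map f xs)))   ≡⟨ cong suc (length-filter-map P? f xs) ⟩
    suc (length (filter (P? ∘ f) xs))     ≡⟨ cong length (filter-accept (P? ∘ f) Pfx) ⟨
    length (filter (P? ∘ f) (x ∷ xs)) ∎
  by-cases (no ¬Pfx) = begin
    length (filter P? (f x ∷ map f xs)) ≡⟨ cong length (filter-reject P? ¬Pfx) ⟩
    length (filter P? (map f xs))         ≡⟨ length-filter-map P? f xs ⟩
    length (filter (P? ∘ f) xs)           ≡⟨ cong length (filter-reject (P? ∘ f) ¬Pfx) ⟨
    length (filter (P? ∘ f) (x ∷ xs)) ∎

length-filter-cartesianProduct :
  ∀ {A B : Set} {P : Pred (A × B) 0ℓ} (P? : Decidable P) xs (ys : List B) →
  length (filter P? (cartesianProduct xs ys)) ≡ sum (map (λ x → length (filter (P? ∘ (x ,_)) ys)) xs)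
length-filter-cartesianProduct P? [] ys = refl
length-filter-cartesianProduct P? (x ∷ xs) ys = begin
  length (filter P? (map (x ,_) ys ++ cartesianProduct xs ys))
    ≡⟨ cong length (filter-++ P? (map (x ,_) ys) _) ⟩
  length (filter P? (map (x ,_) ys) ++ filter P? (cartesianProduct xs ys))
    ≡⟨ length-++ (filter P? (map (x ,_) ys)) ⟩
  length (filter P? (map (x ,_) ys)) + length (filter P? (cartesianProduct xs ys))
    ≡⟨ cong₂ _+_ (length-filter-map P? (x ,_) ys) (length-filter-cartesianProduct P? xs ys) ⟩
  sum (map (λ x → length (filter (P? ∘ (x ,_)) ys)) (x ∷ xs)) ∎
  where open ≡-Reasoning

allFin-suc : ∀ n → allFin (suc n) ≡ fz ∷ map fs (allFin n)
allFin-suc n = cong (fz ∷_) (sym (map-tabulate id fs))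

count-above : ∀ n k → length (filter (λ (v : Fin n) → k <? toℕ v) (allFin n)) ≡ n ∸ suc k
count-above zero k = refl
count-above (suc n) k = begin
  length (filter (λ v → k <? toℕ v) (allFin (suc n)))
    ≡⟨ cong (length ∘ filter (λ v → k <? toℕ v)) (allFin-suc n) ⟩
  length (filter (λ v → k <? toℕ v) (fz ∷ map fs (allFin n)))
    ≡⟨ cong length (filter-reject (λ v → k <? toℕ v) {fz} {map fs (allFin n)} λ ()) ⟩
  length (filter (λ v → k <? toℕ v) (map fs (allFin n)))
    ≡⟨ length-filter-map (λ v → k <? toℕ v) fs (allFin n) ⟩
  length (filter (λ v → k <? suc (toℕ v)) (allFin n))
    ≡⟨ shift k ⟩
  n ∸ k ∎
  where
  open ≡-Reasoning
  shift : ∀ k → length (filter (λ v → k <? suc (toℕ v)) (allFin n)) ≡ n ∸ k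
  shift zero =
    trans (cong length (filter-all (λ v → 0 <? suc (toℕ v)) (universal (λ _ → z<s) (allFin n))))
          (length-tabulate id)
  shift (suc k) =
    trans (cong length (filter-≐ _ _ ((λ { (s≤s p) → p }) , s≤s) (allFin n))) (count-above n k)

sum-descending : ∀ n → sum (tabulate (λ (u : Fin n) → n ∸ suc (toℕ u))) ≡ n C 2
sum-descending zero = refl
sum-descending (suc n) = begin
  n + sum (tabulate (λ (u : Fin n) → n ∸ suc (toℕ u))) ≡⟨ cong (_+_ n) (sum-descending n) ⟩
  n + n C 2                                              ≡⟨ cong (_+ n C 2) (sym (nC1≡n n)) ⟩
  n C 1 + n C 2                                          ≡⟨ nCk+nC[k+1]≡[n+1]C[k+1] n 1 ⟩
  suc n C 2 ∎
  where open ≡-Reasoning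

allPairs : ∀ n → List (Fin n × Fin n)
allPairs n = cartesianProduct (allFin n) (allFin n)

Ascending? : ∀ n → Decidable (λ (p : Fin n × Fin n) → toℕ (proj₁ p) < toℕ (proj₂ p))
Ascending? n (u , v) = toℕ u <? toℕ v

count-ascending : ∀ n → length (filter (Ascending? n) (allPairs n)) ≡ n C 2
count-ascending n = begin
  length (filter (Ascending? n) (allPairs n))
    ≡⟨ length-filter-cartesianProduct (Ascending? n) (allFin n) (allFin n) ⟩
  sum (map (λ u → length (filter (λ v → toℕ u <? toℕ v) (allFin n))) (allFin n))
    ≡⟨ cong sum (map-cong (count-above n ∘ toℕ) (allFin n)) ⟩
  sum (map (λ u → n ∸ suc (toℕ u)) (allFin n))
    ≡⟨ cong sum (map-tabulate {n = n} id (λ u → n ∸ suc (toℕ u))) ⟩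
  sum (tabulate (λ (u : Fin n) → n ∸ suc (toℕ u)))
    ≡⟨ sum-descending n ⟩
  n C 2 ∎
  where open ≡-Reasoning

numEdges-≤ : ∀ {n} (G : EOGraph n) → numEdges G ≤ n C 2
numEdges-≤ {n} G = begin
  numEdges G
    ≤⟨ length-mono-≤ (filter⁺ _ (Ascending? n) (λ { refl → proj₁ }) (⊆-refl {x = allPairs n})) ⟩
  length (filter (Ascending? n) (allPairs n))
    ≡⟨ count-ascending n ⟩
  n C 2 ∎
  where open ≤-Reasoning

*+-lex-< : ∀ {n a b c} d → b < n → a < c → a * n + b < c * n + d
*+-lex-< {n} {a} {b} {c} d b<n a<c = begin-strict
  a * n + b <⟨ +-monoʳ-< (a * n) b<n ⟩
  a * n + n ≡⟨ +-comm (a * n) n ⟩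
  suc a * n ≤⟨ *-monoˡ-≤ n a<c ⟩
  c * n     ≤⟨ m≤m+n (c * n) d ⟩
  c * n + d ∎
  where open ≤-Reasoning

*+-<⇒≤ : ∀ {n a b c d} → b < n → d < n → a * n + b < c * n + d → a ≤ c
*+-<⇒≤ {b = b} b<n d<n lt = ≮⇒≥ λ c<a → <-asym lt (*+-lex-< b d<n c<a)

*+-injective : ∀ {n a b c d} → b < n → d < n → a * n + b ≡ c * n + d → a ≡ c × b ≡ d
*+-injective {n} {a} {b} {c} {d} b<n d<n eq
  with refl ← ≤-antisym {a} {c} (≮⇒≥ λ c<a → <-irrefl (sym eq) (*+-lex-< b d<n c<a))
                        (≮⇒≥ λ a<c → <-irrefl eq (*+-lex-< d b<n a<c))
  = refl , +-cancelˡ-≡ (a * n) b d eq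

⊓-⊔-sorted : ∀ a b → (a ≡ a ⊓ b × b ≡ a ⊔ b) ⊎ (a ≡ a ⊔ b × b ≡ a ⊓ b)
⊓-⊔-sorted a b with ≤-total a b
... | inj₁ a≤b = inj₁ (sym (m≤n⇒m⊓n≡m a≤b) , sym (m≤n⇒m⊔n≡n a≤b))
... | inj₂ b≤a = inj₂ (sym (m≥n⇒m⊔n≡m b≤a) , sym (m≥n⇒m⊓n≡n b≤a))

⊓-⊔-injective : ∀ {a b c d} → a ⊓ b ≡ c ⊓ d → a ⊔ b ≡ c ⊔ d →
                (a ≡ c × b ≡ d) ⊎ (a ≡ d × b ≡ c)
⊓-⊔-injective {a} {b} {c} {d} ⊓≡ ⊔≡ = match (⊓-⊔-sorted a b) (⊓-⊔-sorted c d)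
  where
  via : ∀ {x y p q : ℕ} → x ≡ p → p ≡ q → y ≡ q → x ≡ y
  via x≡p p≡q y≡q = trans x≡p (trans p≡q (sym y≡q))
  match : (a ≡ a ⊓ b × b ≡ a ⊔ b) ⊎ (a ≡ a ⊔ b × b ≡ a ⊓ b) →
          (c ≡ c ⊓ d × d ≡ c ⊔ d) ⊎ (c ≡ c ⊔ d × d ≡ c ⊓ d) →
          (a ≡ c × b ≡ d) ⊎ (a ≡ d × b ≡ c)
  match (inj₁ (a₋ , b₊)) (inj₁ (c₋ , d₊)) = inj₁ (via a₋ ⊓≡ c₋ , via b₊ ⊔≡ d₊)
  match (inj₁ (a₋ , b₊)) (inj₂ (c₊ , d₋)) = inj₂ (via a₋ ⊓≡ d₋ , via b₊ ⊔≡ c₊)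
  match (inj₂ (a₊ , b₋)) (inj₁ (c₋ , d₊)) = inj₂ (via a₊ ⊔≡ d₊ , via b₋ ⊓≡ c₋)
  match (inj₂ (a₊ , b₋)) (inj₂ (c₊ , d₋)) = inj₁ (via a₊ ⊔≡ c₊ , via b₋ ⊓≡ d₋)

≤∧≢⇒<-⊔ : ∀ {x d e} → x ≤ d ⊔ e → x ≢ d → x ≢ e → x < d ⊔ e
≤∧≢⇒<-⊔ {x} {d} {e} x≤ x≢d x≢e =
  ≤∧≢⇒< x≤ λ x≡ → [ x≢d ∘ trans x≡ , x≢e ∘ trans x≡ ]′ (⊔-sel d e)

⊔-middle-< : ∀ {a b c d e} → b ≢ d → b ≢ e → c ≢ d → c ≢ e →
             a ⊔ b ≤ d ⊔ e → c ⊔ d ≤ d ⊔ e → b ⊔ c < d ⊔ e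
⊔-middle-< {a} {b} {c} {d} b≢d b≢e c≢d c≢e ab≤de cd≤de = ⊔-pres-<m
  (≤∧≢⇒<-⊔ (≤-trans (m≤n⊔m a b) ab≤de) b≢d b≢e)
  (≤∧≢⇒<-⊔ (≤-trans (m≤m⊔n c d) cd≤de) c≢d c≢e)

module Complete (n : ℕ) where

  -- (max, min) written in base n, so comparing keys is colex order on 2-sets.
  colex : Fin n → Fin n → ℕ
  colex u v = (toℕ u ⊔ toℕ v) * n + (toℕ u ⊓ toℕ v)

  colex-sym : ∀ u v → colex u v ≡ colex v u
  colex-sym u v = cong₂ (λ x y → x * n + y) (⊔-comm (toℕ u) (toℕ v)) (⊓-comm (toℕ u) (toℕ v))

  ⊓<n : ∀ (u v : Fin n) → toℕ u ⊓ toℕ v < n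
  ⊓<n u v = ≤-<-trans (m⊓n≤m (toℕ u) (toℕ v)) (toℕ<n u)

  colex-injective : ∀ u v x y → colex u v ≡ colex x y → (u ≡ x × v ≡ y) ⊎ (u ≡ y × v ≡ x)
  colex-injective u v x y eq with *+-injective (⊓<n u v) (⊓<n x y) eq
  ... | ⊔≡ , ⊓≡ with ⊓-⊔-injective ⊓≡ ⊔≡
  ... | inj₁ (u≡x , v≡y) = inj₁ (toℕ-injective u≡x , toℕ-injective v≡y)
  ... | inj₂ (u≡y , v≡x) = inj₂ (toℕ-injective u≡y , toℕ-injective v≡x)

  colex-<⇒⊔-≤ : ∀ u v x y → colex u v < colex x y → toℕ u ⊔ toℕ v ≤ toℕ x ⊔ toℕ y
  colex-<⇒⊔-≤ u v x y = *+-<⇒≤ (⊓<n u v) (⊓<n x y)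

  label : Fin n → Fin n → Maybe ℕ
  label u v with u ≟ᶠ v
  ... | yes _ = nothing
  ... | no _  = just (colex u v)

  label-edge : ∀ {u v} → u ≢ v → label u v ≡ just (colex u v)
  label-edge {u} {v} u≢v with u ≟ᶠ v
  ... | yes u≡v = contradiction u≡v u≢v
  ... | no _    = refl

  label-colex : ∀ {u v k} → label u v ≡ just k → colex u v ≡ k
  label-colex {u} {v} eq with u ≟ᶠ v
  label-colex () | yes _
  label-colex eq | no _ = just-injective eq

  label-sym : ∀ u v → label u v ≡ label v u
  label-sym u v with u ≟ᶠ v | v ≟ᶠ u
  ... | yes _   | yes _   = refl
  ... | yes u≡v | no v≢u  = contradiction (sym u≡v) v≢u
  ... | no u≢v  | yes v≡u = contradiction (sym v≡u) u≢v
  ... | no _    | no _    = cong just (colex-sym u v)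

  label-irrefl : ∀ u → label u u ≡ nothing
  label-irrefl u with u ≟ᶠ u
  ... | yes _   = refl
  ... | no u≢u  = contradiction refl u≢u

  label-injective : ∀ u v x y k → label u v ≡ just k → label x y ≡ just k →
                    (u ≡ x × v ≡ y) ⊎ (u ≡ y × v ≡ x)
  label-injective u v x y k uv≡k xy≡k =
    colex-injective u v x y (trans (label-colex uv≡k) (sym (label-colex xy≡k)))

  complete : EOGraph n
  complete = record
    { lab = label ; lab-sym = label-sym ; lab-irrefl = label-irrefl ; lab-inj = label-injective }

  avoids : ∀ a → a (# 0) < a (# 3) → a (# 2) < a (# 3) → a (# 3) < a (# 1) →
           ¬ ContainsP5 complete a
  avoids a a₁<a₄ a₃<a₄ a₄<a₂ (w , w-inj , ℓ , path , order) =
    <⇒≱ (⊔-middle-< (apart λ ()) (apart λ ()) (apart λ ()) (apart λ ())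
                    (edge-⊔ (# 0) (# 3) a₁<a₄) (edge-⊔ (# 2) (# 3) a₃<a₄))
        (edge-⊔ (# 3) (# 1) a₄<a₂)
    where
    apart : ∀ {i j} → i ≢ j → toℕ (w i) ≢ toℕ (w j)
    apart i≢j eq = i≢j (w-inj (toℕ-injective eq))
    edge-⊔ : ∀ (i j : Fin 4) → a i < a j →
             toℕ (w (inject₁ i)) ⊔ toℕ (w (fs i)) ≤ toℕ (w (inject₁ j)) ⊔ toℕ (w (fs j))
    edge-⊔ i j aᵢ<aⱼ = colex-<⇒⊔-≤ (w (inject₁ i)) (w (fs i)) (w (inject₁ j)) (w (fs j))
      (subst₂ _<_ (sym (label-colex (path i))) (sym (label-colex (path j))) (order i j aᵢ<aⱼ))

  numEdges-complete : numEdges complete ≡ n C 2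
  numEdges-complete =
    trans (cong length (filter-≐ _ (Ascending? n) (proj₁ , λ u<v → u<v , is-edge u<v) (allPairs n)))
          (count-ascending n)
    where
    is-edge : ∀ {u v} → toℕ u < toℕ v → T (is-just (label u v))
    is-edge {u} {v} u<v = subst (T ∘ is-just) (sym (label-edge λ { refl → <-irrefl refl u<v })) tt

  exP5≡-complete : ∀ a → ¬ ContainsP5 complete a → ExP5≡ n a (n C 2)
  exP5≡-complete a complete-avoids =
    (complete , complete-avoids , numEdges-complete) , λ G _ → numEdges-≤ G

open Complete using (avoids; exP5≡-complete)

proposition4p10 : ∀ (n : ℕ) → ExP5≡ n p1423 (n C 2) × ExP5≡ n p2413 (n C 2)
proposition4p10 n =
  exP5≡-complete n p1423 (avoids n p1423 (s<s z<s) (s<s (s<s z<s)) (s<s (s<s (s<s z<s)))) ,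
  exP5≡-complete n p2413 (avoids n p2413 (s<s (s<s z<s)) (s<s z<s) (s<s (s<s (s<s z<s))))
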